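{- Let $\Gamma;s$ be an extended context and let $\lambda x\leq t.u$ and $\lambda x\leq t'.u'$ be terms. If $\Gamma;s\vdash(\lambda x\leq t.u)\leq^*(\lambda x\leq t'.u')$ then $\Gamma;s\vdash t\equiv t'$.
   Context: Terms: $t ::= x \mid \top \mid (\lambda x\leq t.u) \mid (u\,v)$, with $x$ from a countably infinite set of variables and $\top$ a constant; $x$ is bound in $u$ in $\lambda x\leq t.u$; terms identified up to renaming of bound variables; $\mathrm{fv}$ = free variables, $u[x:=v]$ = capture-avoiding substitution. Extended context $\Gamma;s$: a finite sequence $\Gamma$ of annotations $x\leq t$ and a finite list (stack) $s$ of terms; $\varepsilon;[]$ empty, $\Gamma,x\leq t;s$ appends an annotation, $\Gamma;\alpha::s$ pushes $\alpha$. $\mathrm{dom}(\Gamma)$ = annotated variables; $x\leq t\in\Gamma$ means the annotation occurs in $\Gamma$. Prevalidity: least predicate with $\varepsilon;[]$ prevalid; $\Gamma,x\leq t;[]$ prevalid if $\Gamma;[]$ prevalid, $x\notin\mathrm{dom}(\Gamma)$, $\mathrm{fv}(t)\subseteq\mathrm{dom}(\Gamma)$; $\Gamma;\alpha::s$ prevalid if $\Gamma;s$ prevalid and $\mathrm{fv}(\alpha)\subseteq\mathrm{dom}(\Gamma)$. Equivalence reduction $\to_{\equiv}$: least relation with $x\to_{\equiv}x$; $\top\to_{\equiv}\top$; $\top\,u\to_{\equiv}\top$; if $u\to_{\equiv}u'$, $v\to_{\equiv}v'$ then $u\,v\to_{\equiv}u'\,v'$ and $(\lambda x\leq t.u)\,v\to_{\equiv}u'[x:=v']$;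 if $t\to_{\equiv}t'$, $u\to_{\equiv}u'$ then $\lambda x\leq t.u\to_{\equiv}\lambda x\leq t'.u'$. Subtyping reduction $\Gamma;s\vdash u\to_{\leq}v$: least relation with (Prom) $\Gamma;s$ prevalid and $x\leq t\in\Gamma$ give $\Gamma;s\vdash x\to_{\leq}t$; (Top) $\Gamma;s$ prevalid gives $\Gamma;s\vdash u\to_{\leq}\top$; (Eq) $\Gamma;s$ prevalid and $u\to_{\equiv}v$ give $\Gamma;s\vdash u\to_{\leq}v$; (App) $\Gamma;v::s\vdash u\to_{\leq}u'$ gives $\Gamma;s\vdash u\,v\to_{\leq}u'\,v$; (FunOp) $\Gamma,x\leq\alpha;s\vdash u\to_{\leq}u'$ gives $\Gamma;\alpha::s\vdash\lambda x\leq t.u\to_{\leq}\lambda x\leq t.u'$; (Fun) $\Gamma,x\leq t;[]\vdash u\to_{\leq}u'$ gives $\Gamma;[]\vdash\lambda x\leq t.u\to_{\leq}\lambda x\leq t.u'$. Subtyping and equivalence: for $\lhd\in\{\leq,\equiv\}$, let $\to_{\lhd}$ be $\to_{\leq}$ (in context $\Gamma;s$) resp. $\to_{\equiv}$. $\Gamma;s\vdash v\lhd t$ is the least relation with: if $\Gamma;s$ prevalid then $\Gamma;s\vdash t\lhd t$; if $\Gamma;s\vdash v\to_{\lhd}v'$ and $\Gamma;s\vdash v'\lhd t$ then $\Gamma;s\vdash v\lhd t$; if $\Gamma;s\vdash v\lhd t'$ and $t\to_{\equiv}t'$ then $\Gamma;s\vdash v\lhd t$. Transitive subtyping $\Gamma;s\vdash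 v\leq^*t$ is the transitive closure (for fixed $\Gamma;s$) of $\Gamma;s\vdash\cdot\leq\cdot$. -}

module Defs where

open import Data.Nat using (ℕ; zero; suc; _<_)
open import Data.List using (List; []; _∷_; length; map)
open import Relation.Binary.Construct.Closure.Transitive using (TransClosure)

-- Terms up to α-equivalence: de Bruijn indices (var 0 = innermost binder /
-- most recent context annotation).
-- lam t u  represents  λ x ≤ t . u   (x bound in u only).
data Term : Set where
  var : ℕ → Term
  top : Term
  lam : Term → Term → Term
  app : Term → Term → Term

ext : (ℕ → ℕ) → ℕ → ℕ
ext ρ zero    = zero
ext ρ (suc i) = suc (ρ i)

rename : (ℕ → ℕ) → Term → Term
rename ρ (var i)   = var (ρ i)
rename ρ top       = top
rename ρ (lam t u) = lam (rename ρ t) (rename (ext ρ) u)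
rename ρ (app u v) = app (rename ρ u) (rename ρ v)

wk : Term → Term
wk = rename suc

exts : (ℕ → Term) → ℕ → Term
exts σ zero    = var zero
exts σ (suc i) = wk (σ i)

subst : (ℕ → Term) → Term → Term
subst σ (var i)   = σ i
subst σ top       = top
subst σ (lam t u) = lam (subst σ t) (subst (exts σ) u)
subst σ (app u v) = app (subst σ u) (subst σ v)

sub0 : Term → ℕ → Term
sub0 v zero    = v
sub0 v (suc i) = var i

_[0:=_] : Term → Term → Term
u [0:= v ] = subst (sub0 v) u

-- fv(t) ⊆ dom(Γ) when |Γ| = n : all free indices are < n
data Scoped : ℕ → Term → Set where
  s-var : ∀ {n i} → i < n → Scoped n (var i)
  s-top : ∀ {n} → Scoped n top
  s-lam : ∀ {n t u} → Scoped n t → Scoped (suc n) u → Scoped n (lam t u)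
  s-app : ∀ {n u v} → Scoped n u → Scoped n v → Scoped n (app u v)

-- Contexts: list of annotation bounds, most recent first;
-- (t ∷ Γ) is  Γ , x ≤ t   (t lives in the scope of Γ).
Ctx : Set
Ctx = List Term

-- Stacks: list of terms, head = top of stack; α ∷ s is α :: s.
Stack : Set
Stack = List Term

-- Γ ∋ i ≤ t : the annotation of variable i in Γ, weakened to the scope of Γ.
data _∋_≤_ : Ctx → ℕ → Term → Set where
  here  : ∀ {Γ a} → (a ∷ Γ) ∋ zero ≤ wk a
  there : ∀ {Γ a i t} → Γ ∋ i ≤ t → (a ∷ Γ) ∋ suc i ≤ wk t

-- Prevalidity (freshness x ∉ dom(Γ) is automatic with de Bruijn indices)
data Prevalid : Ctx → Stack → Set where
  pv-empty : Prevalid [] []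
  pv-ext   : ∀ {Γ t} → Prevalid Γ [] → Scoped (length Γ) t → Prevalid (t ∷ Γ) []
  pv-push  : ∀ {Γ s α} → Prevalid Γ s → Scoped (length Γ) α → Prevalid Γ (α ∷ s)

data _→≡_ : Term → Term → Set where
  ≡-var  : ∀ {x} → var x →≡ var x
  ≡-top  : top →≡ top
  ≡-topapp : ∀ {u} → app top u →≡ top
  ≡-app  : ∀ {u u' v v'} → u →≡ u' → v →≡ v' → app u v →≡ app u' v'
  ≡-beta : ∀ {t u u' v v'} → u →≡ u' → v →≡ v' → app (lam t u) v →≡ (u' [0:= v' ])
  ≡-lam  : ∀ {t t' u u'} → t →≡ t' → u →≡ u' → lam t u →≡ lam t' u'

-- Subtyping reduction  Γ;s ⊢ u →≤ v
-- (in FunOp the stack terms are weakened, as they move under the new binder)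
data _⨾_⊢_→≤_ : Ctx → Stack → Term → Term → Set where
  Prom  : ∀ {Γ s i t} → Prevalid Γ s → Γ ∋ i ≤ t → Γ ⨾ s ⊢ var i →≤ t
  Top   : ∀ {Γ s u} → Prevalid Γ s → Γ ⨾ s ⊢ u →≤ top
  Eq    : ∀ {Γ s u v} → Prevalid Γ s → u →≡ v → Γ ⨾ s ⊢ u →≤ v
  App   : ∀ {Γ s u u' v} → Γ ⨾ (v ∷ s) ⊢ u →≤ u' → Γ ⨾ s ⊢ app u v →≤ app u' v
  FunOp : ∀ {Γ s α t u u'} → (α ∷ Γ) ⨾ map wk s ⊢ u →≤ u' →
          Γ ⨾ (α ∷ s) ⊢ lam t u →≤ lam t u'
  Fun   : ∀ {Γ t u u'} → (t ∷ Γ) ⨾ [] ⊢ u →≤ u' → Γ ⨾ [] ⊢ lam t u →≤ lam t u'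

data Closure (R : Ctx → Stack → Term → Term → Set) (Γ : Ctx) (s : Stack) : Term → Term → Set where
  c-refl : ∀ {t} → Prevalid Γ s → Closure R Γ s t t
  c-step : ∀ {v v' t} → R Γ s v v' → Closure R Γ s v' t → Closure R Γ s v t
  c-back : ∀ {v t t'} → Closure R Γ s v t' → t →≡ t' → Closure R Γ s v t

_⨾_⊢_≤_ : Ctx → Stack → Term → Term → Set
Γ ⨾ s ⊢ v ≤ t = Closure _⨾_⊢_→≤_ Γ s v t

_⨾_⊢_≡_ : Ctx → Stack → Term → Term → Set
Γ ⨾ s ⊢ v ≡ t = Closure (λ _ _ → _→≡_) Γ s v t

_⨾_⊢_≤*_ : Ctx → Stack → Term → Term → Set
Γ ⨾ s ⊢ v ≤* t = TransClosure (Γ ⨾ s ⊢_≤_) v t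

-- A subtyping-reduction step commutes with parallel equivalence reduction →≡: if v →≤ v'
-- and v →≡ w, then w →≤ w' for some w' with v' →≡* w'. Consequently the property
-- "y →≡* ⊤, or y →≡* λ x ≤ a . b for some a with t →≡* a" is preserved along ≤ and ≤*:
-- forward steps by commutation (a →≤-step on an abstraction yields ⊤ or moves its bound
-- by one →≡-step), backward →≡-steps trivially. It holds for λ x ≤ t . u, and an
-- abstraction never reduces to ⊤, so λ x ≤ t' . u' →≡* λ x ≤ a . b with t →≡* a and
-- t' →≡* a; hence t ≡ t'.
module Submission where

open import Defs
open import Data.Nat using (ℕ; zero; suc)
open import Data.List using ([]; _∷_; map)
open import Data.List.Properties using (map-∘; map-cong; map-id)
open import Data.List.Relation.Binary.Pointwise as Pointwise using (Pointwise; []; _∷_)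
open import Data.Product using (∃-syntax; _×_; _,_)
open import Data.Sum using (_⊎_; inj₁; inj₂)
open import Function using (id; _∘_)
open import Relation.Binary.PropositionalEquality
  using (_≡_; _≗_; refl; sym; trans; cong; cong₂) renaming (subst to transport)
open import Relation.Binary.Construct.Closure.ReflexiveTransitive using (Star; ε; _◅_; _◅◅_; gmap)
open import Relation.Binary.Construct.Closure.Transitive using ([_]; _∷_)

private variable
  Γ : Ctx
  s : Stack
  a a' b t t' u u' v v' w : Term
  ρ ρ' : ℕ → ℕ
  σ τ : ℕ → Term

ext-cong : ρ ≗ ρ' → ext ρ ≗ ext ρ'
ext-cong h zero    = refl
ext-cong h (suc i) = cong suc (h i)

exts-cong : σ ≗ τ → exts σ ≗ exts τ
exts-cong h zero    = refl
exts-cong h (suc i) = cong wk (h i)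

rename-cong : ρ ≗ ρ' → rename ρ ≗ rename ρ'
rename-cong h (var i)   = cong var (h i)
rename-cong h top       = refl
rename-cong h (lam t u) = cong₂ lam (rename-cong h t) (rename-cong (ext-cong h) u)
rename-cong h (app u v) = cong₂ app (rename-cong h u) (rename-cong h v)

subst-cong : σ ≗ τ → subst σ ≗ subst τ
subst-cong h (var i)   = h i
subst-cong h top       = refl
subst-cong h (lam t u) = cong₂ lam (subst-cong h t) (subst-cong (exts-cong h) u)
subst-cong h (app u v) = cong₂ app (subst-cong h u) (subst-cong h v)

ext-∘ : ext ρ ∘ ext ρ' ≗ ext (ρ ∘ ρ')
ext-∘ zero    = refl
ext-∘ (suc i) = refl

exts-ext : exts σ ∘ ext ρ ≗ exts (σ ∘ ρ)
exts-ext zero    = refl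
exts-ext (suc i) = refl

rename-rename : ∀ ρ ρ' → rename ρ ∘ rename ρ' ≗ rename (ρ ∘ ρ')
rename-rename ρ ρ' (var i)   = refl
rename-rename ρ ρ' top       = refl
rename-rename ρ ρ' (lam t u) =
  cong₂ lam (rename-rename ρ ρ' t) (trans (rename-rename (ext ρ) (ext ρ') u) (rename-cong ext-∘ u))
rename-rename ρ ρ' (app u v) = cong₂ app (rename-rename ρ ρ' u) (rename-rename ρ ρ' v)

subst-rename : ∀ σ ρ → subst σ ∘ rename ρ ≗ subst (σ ∘ ρ)
subst-rename σ ρ (var i)   = refl
subst-rename σ ρ top       = refl
subst-rename σ ρ (lam t u) =
  cong₂ lam (subst-rename σ ρ t) (trans (subst-rename (exts σ) (ext ρ) u) (subst-cong exts-ext u))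
subst-rename σ ρ (app u v) = cong₂ app (subst-rename σ ρ u) (subst-rename σ ρ v)

rename-subst : ∀ ρ σ → rename ρ ∘ subst σ ≗ subst (rename ρ ∘ σ)
rename-subst ρ σ (var i)   = refl
rename-subst ρ σ top       = refl
rename-subst ρ σ (lam t u) =
  cong₂ lam (rename-subst ρ σ t) (trans (rename-subst (ext ρ) (exts σ) u) (subst-cong rename-exts u))
  where
  rename-exts : rename (ext ρ) ∘ exts σ ≗ exts (rename ρ ∘ σ)
  rename-exts zero    = refl
  rename-exts (suc i) = trans (rename-rename (ext ρ) suc (σ i)) (sym (rename-rename suc ρ (σ i)))
rename-subst ρ σ (app u v) = cong₂ app (rename-subst ρ σ u) (rename-subst ρ σ v)

subst-exts-wk : ∀ σ → subst (exts σ) ∘ wk ≗ wk ∘ subst σ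
subst-exts-wk σ t = trans (subst-rename (exts σ) suc t) (sym (rename-subst suc σ t))

subst-subst : ∀ τ σ → subst τ ∘ subst σ ≗ subst (subst τ ∘ σ)
subst-subst τ σ (var i)   = refl
subst-subst τ σ top       = refl
subst-subst τ σ (lam t u) =
  cong₂ lam (subst-subst τ σ t) (trans (subst-subst (exts τ) (exts σ) u) (subst-cong subst-exts u))
  where
  subst-exts : subst (exts τ) ∘ exts σ ≗ exts (subst τ ∘ σ)
  subst-exts zero    = refl
  subst-exts (suc i) = subst-exts-wk τ (σ i)
subst-subst τ σ (app u v) = cong₂ app (subst-subst τ σ u) (subst-subst τ σ v)

subst-var : subst var ≗ id
subst-var (var i)   = refl
subst-var top       = refl
subst-var (lam t u) = cong₂ lam (subst-var t) (trans (subst-cong exts-var u) (subst-var u))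
  where
  exts-var : exts var ≗ var
  exts-var zero    = refl
  exts-var (suc i) = refl
subst-var (app u v) = cong₂ app (subst-var u) (subst-var v)

wk-[0:=] : ∀ a → (_[0:= a ]) ∘ wk ≗ id
wk-[0:=] a t = trans (subst-rename (sub0 a) suc t) (subst-var t)

subst-[0:=] : ∀ σ u v → subst σ (u [0:= v ]) ≡ subst (exts σ) u [0:= subst σ v ]
subst-[0:=] σ u v =
  trans (subst-subst σ (sub0 v) u)
        (trans (subst-cong σ∘sub0 u) (sym (subst-subst (sub0 (subst σ v)) (exts σ) u)))
  where
  σ∘sub0 : subst σ ∘ sub0 v ≗ subst (sub0 (subst σ v)) ∘ exts σ
  σ∘sub0 zero    = refl
  σ∘sub0 (suc i) = sym (wk-[0:=] (subst σ v) (σ i))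

rename-[0:=] : ∀ ρ u v → rename ρ (u [0:= v ]) ≡ rename (ext ρ) u [0:= rename ρ v ]
rename-[0:=] ρ u v =
  trans (rename-subst ρ (sub0 v) u)
        (trans (subst-cong ρ∘sub0 u) (sym (subst-rename (sub0 (rename ρ v)) (ext ρ) u)))
  where
  ρ∘sub0 : rename ρ ∘ sub0 v ≗ sub0 (rename ρ v) ∘ ext ρ
  ρ∘sub0 zero    = refl
  ρ∘sub0 (suc i) = refl

map-subst-exts-wk : ∀ σ s → map (subst (exts σ)) (map wk s) ≡ map wk (map (subst σ) s)
map-subst-exts-wk σ s = trans (sym (map-∘ s)) (trans (map-cong (subst-exts-wk σ) s) (map-∘ s))

map-wk-[0:=] : ∀ a s → map (_[0:= a ]) (map wk s) ≡ s
map-wk-[0:=] a s = trans (sym (map-∘ s)) (trans (map-cong (wk-[0:=] a) s) (map-id s))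

_→*_ : Term → Term → Set
_→*_ = Star _→≡_

→≡-refl : t →≡ t
→≡-refl {var x}   = ≡-var
→≡-refl {top}     = ≡-top
→≡-refl {lam t u} = ≡-lam →≡-refl →≡-refl
→≡-refl {app u v} = ≡-app →≡-refl →≡-refl

rename-→≡ : ∀ ρ → u →≡ u' → rename ρ u →≡ rename ρ u'
rename-→≡ ρ ≡-var       = ≡-var
rename-→≡ ρ ≡-top       = ≡-top
rename-→≡ ρ ≡-topapp    = ≡-topapp
rename-→≡ ρ (≡-app p q) = ≡-app (rename-→≡ ρ p) (rename-→≡ ρ q)
rename-→≡ ρ (≡-beta {u' = u'} {v' = v'} p q) =
  transport (_ →≡_) (sym (rename-[0:=] ρ u' v'))
            (≡-beta (rename-→≡ (ext ρ) p) (rename-→≡ ρ q))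
rename-→≡ ρ (≡-lam p q) = ≡-lam (rename-→≡ ρ p) (rename-→≡ (ext ρ) q)

exts-→≡ : (∀ i → σ i →≡ τ i) → ∀ i → exts σ i →≡ exts τ i
exts-→≡ h zero    = ≡-var
exts-→≡ h (suc i) = rename-→≡ suc (h i)

subst-→≡ : (∀ i → σ i →≡ τ i) → u →≡ u' → subst σ u →≡ subst τ u'
subst-→≡ h (≡-var {x}) = h x
subst-→≡ h ≡-top       = ≡-top
subst-→≡ h ≡-topapp    = ≡-topapp
subst-→≡ h (≡-app p q) = ≡-app (subst-→≡ h p) (subst-→≡ h q)
subst-→≡ {τ = τ} h (≡-beta {u' = u'} {v' = v'} p q) =
  transport (_ →≡_) (sym (subst-[0:=] τ u' v'))
            (≡-beta (subst-→≡ (exts-→≡ h) p) (subst-→≡ h q))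
subst-→≡ h (≡-lam p q) = ≡-lam (subst-→≡ h p) (subst-→≡ (exts-→≡ h) q)

[0:=]-→≡ : u →≡ u' → v →≡ v' → (u [0:= v ]) →≡ (u' [0:= v' ])
[0:=]-→≡ p q = subst-→≡ sub0-→≡ p
  where
  sub0-→≡ : ∀ i → sub0 _ i →≡ sub0 _ i
  sub0-→≡ zero    = q
  sub0-→≡ (suc i) = ≡-var

→≡-diamond : u →≡ a → u →≡ b → ∃[ m ] a →≡ m × b →≡ m
→≡-diamond ≡-var ≡-var                  = _ , ≡-var , ≡-var
→≡-diamond ≡-top ≡-top                  = _ , ≡-top , ≡-top
→≡-diamond ≡-topapp ≡-topapp            = _ , ≡-top , ≡-top
→≡-diamond ≡-topapp (≡-app ≡-top q)     = _ , ≡-top , ≡-topapp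
→≡-diamond (≡-app ≡-top q) ≡-topapp     = _ , ≡-topapp , ≡-top
→≡-diamond (≡-app p q) (≡-app p' q') with →≡-diamond p p' | →≡-diamond q q'
... | _ , a₁ , b₁ | _ , a₂ , b₂ = _ , ≡-app a₁ a₂ , ≡-app b₁ b₂
→≡-diamond (≡-app (≡-lam _ p) q) (≡-beta p' q') with →≡-diamond p p' | →≡-diamond q q'
... | _ , a₁ , b₁ | _ , a₂ , b₂ = _ , ≡-beta a₁ a₂ , [0:=]-→≡ b₁ b₂
→≡-diamond (≡-beta p q) (≡-app (≡-lam _ p') q') with →≡-diamond p p' | →≡-diamond q q'
... | _ , a₁ , b₁ | _ , a₂ , b₂ = _ , [0:=]-→≡ a₁ a₂ , ≡-beta b₁ b₂
→≡-diamond (≡-beta p q) (≡-beta p' q') with →≡-diamond p p' | →≡-diamond q q'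
... | _ , a₁ , b₁ | _ , a₂ , b₂ = _ , [0:=]-→≡ a₁ a₂ , [0:=]-→≡ b₁ b₂
→≡-diamond (≡-lam p q) (≡-lam p' q') with →≡-diamond p p' | →≡-diamond q q'
... | _ , a₁ , b₁ | _ , a₂ , b₂ = _ , ≡-lam a₁ a₂ , ≡-lam b₁ b₂

app-→* : u →* u' → app u v →* app u' v
app-→* = gmap _ (λ r → ≡-app r →≡-refl)

lam-→* : u →* u' → lam t u →* lam t u'
lam-→* = gmap _ (≡-lam →≡-refl)

lam-→*-inv : lam a b →* w → ∃[ a' ] ∃[ b' ] w ≡ lam a' b' × a →* a'
lam-→*-inv ε = _ , _ , refl , ε
lam-→*-inv (≡-lam p q ◅ rs) with lam-→*-inv rs
... | a' , b' , refl , a↠a' = a' , b' , refl , p ◅ a↠a'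

-- Contexts are replaced by total bound functions so that substituting for a bound variable,
-- which is what β-contracting a FunOp-step requires, stays expressible. Indices outside the
-- context get the junk bound ⊤, harmless since every term reduces to ⊤ anyway.
Bounds : Set
Bounds = ℕ → Term

_◂_ : Term → Bounds → Bounds
(a ◂ B) zero    = wk a
(a ◂ B) (suc i) = wk (B i)

bounds : Ctx → Bounds
bounds []      = λ _ → top
bounds (a ∷ Γ) = a ◂ bounds Γ

bounds-∋ : ∀ {i} → Γ ∋ i ≤ t → bounds Γ i ≡ t
bounds-∋ here      = refl
bounds-∋ (there p) = cong wk (bounds-∋ p)

data _⨾_⊩_↝_ : Bounds → Stack → Term → Term → Set where
  promote  : ∀ {B s i} → B ⨾ s ⊩ var i ↝ B i
  to-top   : ∀ {B s u} → B ⨾ s ⊩ u ↝ top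
  by-→≡    : ∀ {B s u v} → u →≡ v → B ⨾ s ⊩ u ↝ v
  app-head : ∀ {B s u u' v} → B ⨾ (v ∷ s) ⊩ u ↝ u' → B ⨾ s ⊩ app u v ↝ app u' v
  fun-op   : ∀ {B s α t u u'} → (α ◂ B) ⨾ map wk s ⊩ u ↝ u' →
             B ⨾ (α ∷ s) ⊩ lam t u ↝ lam t u'
  fun      : ∀ {B t u u'} → (t ◂ B) ⨾ [] ⊩ u ↝ u' → B ⨾ [] ⊩ lam t u ↝ lam t u'

private variable
  B B' B₀ : Bounds

↝-from-→≤ : Γ ⨾ s ⊢ u →≤ v → bounds Γ ⨾ s ⊩ u ↝ v
↝-from-→≤ {Γ} {s} (Prom {i = i} _ p) =
  transport (λ b → bounds Γ ⨾ s ⊩ var i ↝ b) (bounds-∋ p) promote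
↝-from-→≤ (Top _)   = to-top
↝-from-→≤ (Eq _ e)  = by-→≡ e
↝-from-→≤ (App d)   = app-head (↝-from-→≤ d)
↝-from-→≤ (FunOp d) = fun-op (↝-from-→≤ d)
↝-from-→≤ (Fun d)   = fun (↝-from-→≤ d)

-- Each variable goes either to a variable whose bound is the image of its own bound, or to the
-- image of its own bound (so promoting it becomes a reflexive →≡-step).
MapsBounds : (ℕ → Term) → Bounds → Bounds → Set
MapsBounds σ B B' = ∀ i → (∃[ k ] σ i ≡ var k × B' k ≡ subst σ (B i)) ⊎ σ i ≡ subst σ (B i)

MapsBounds-exts : MapsBounds σ B B' → ∀ α → MapsBounds (exts σ) (α ◂ B) (subst σ α ◂ B')
MapsBounds-exts {σ} m α zero = inj₁ (zero , refl , sym (subst-exts-wk σ α))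
MapsBounds-exts {σ} {B} m α (suc i) with m i
... | inj₁ (k , σi≡k , B'k≡) =
  inj₁ (suc k , cong wk σi≡k , trans (cong wk B'k≡) (sym (subst-exts-wk σ (B i))))
... | inj₂ σi≡ = inj₂ (trans (cong wk σi≡) (sym (subst-exts-wk σ (B i))))

MapsBounds-sub0 : ∀ a B → MapsBounds (sub0 a) (a ◂ B) B
MapsBounds-sub0 a B zero    = inj₂ (sym (wk-[0:=] a a))
MapsBounds-sub0 a B (suc i) = inj₁ (i , refl , sym (wk-[0:=] a (B i)))

subst-↝ : MapsBounds σ B B' → B ⨾ s ⊩ u ↝ u' →
          B' ⨾ map (subst σ) s ⊩ subst σ u ↝ subst σ u'
subst-↝ {σ} {B' = B'} {s} m (promote {i = i}) with m i
... | inj₁ (k , σi≡k , B'k≡) rewrite σi≡k =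
  transport (λ b → B' ⨾ map (subst σ) s ⊩ var k ↝ b) B'k≡ promote
... | inj₂ σi≡ = by-→≡ (transport (σ i →≡_) σi≡ →≡-refl)
subst-↝ m to-top       = to-top
subst-↝ m (by-→≡ e)    = by-→≡ (subst-→≡ (λ _ → →≡-refl) e)
subst-↝ m (app-head d) = app-head (subst-↝ m d)
subst-↝ {σ} m (fun-op {s = s} {α = α} d) =
  fun-op (transport (λ s' → _ ⨾ s' ⊩ _ ↝ _) (map-subst-exts-wk σ s)
                    (subst-↝ (MapsBounds-exts m α) d))
subst-↝ m (fun {t = t} d) = fun (subst-↝ (MapsBounds-exts m t) d)

◂-→≡ : a →≡ a' → (∀ i → B i →≡ B₀ i) → ∀ i → (a ◂ B) i →≡ (a' ◂ B₀) i
◂-→≡ p h zero    = rename-→≡ suc p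
◂-→≡ p h (suc i) = rename-→≡ suc (h i)

map-wk-→≡ : ∀ {s s₀} → Pointwise _→≡_ s s₀ → Pointwise _→≡_ (map wk s) (map wk s₀)
map-wk-→≡ hs = Pointwise.map⁺ wk wk (Pointwise.map (rename-→≡ suc) hs)

↝-→≡-commute : ∀ {s₀} → (∀ i → B i →≡ B₀ i) → Pointwise _→≡_ s s₀ →
               B ⨾ s ⊩ v ↝ v' → v →≡ w → ∃[ w' ] v' →* w' × B₀ ⨾ s₀ ⊩ w ↝ w'
↝-→≡-commute hB hs (promote {i = i}) ≡-var = _ , hB i ◅ ε , promote
↝-→≡-commute hB hs to-top r = top , ε , to-top
↝-→≡-commute hB hs (by-→≡ e) r with →≡-diamond e r
... | m , e' , r' = m , e' ◅ ε , by-→≡ r'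
↝-→≡-commute hB hs (app-head (by-→≡ e)) r with →≡-diamond (≡-app e →≡-refl) r
... | m , e' , r' = m , e' ◅ ε , by-→≡ r'
↝-→≡-commute hB hs (app-head d) (≡-app p q) with ↝-→≡-commute hB (q ∷ hs) d p
... | w' , st , d' = app w' _ , app-→* st ◅◅ (≡-app →≡-refl q ◅ ε) , app-head d'
↝-→≡-commute hB hs (app-head to-top) ≡-topapp     = top , ≡-topapp ◅ ε , to-top
↝-→≡-commute hB hs (app-head to-top) (≡-beta p q) = top , ≡-topapp ◅ ε , to-top
↝-→≡-commute {B₀ = B₀} {s₀ = s₀} hB hs (app-head (fun-op d)) (≡-beta {v' = a₀} p q)
  with ↝-→≡-commute (◂-→≡ q hB) (map-wk-→≡ hs) d p
... | b , st , d' = b [0:= a₀ ] , app-→* (lam-→* st) ◅◅ (≡-beta →≡-refl q ◅ ε) ,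
  transport (λ s' → B₀ ⨾ s' ⊩ _ ↝ _) (map-wk-[0:=] a₀ s₀)
            (subst-↝ (MapsBounds-sub0 a₀ B₀) d')
↝-→≡-commute hB (q ∷ hs) (fun-op d) (≡-lam p₁ p₂)
  with ↝-→≡-commute (◂-→≡ q hB) (map-wk-→≡ hs) d p₂
... | b , st , d' = lam _ b , lam-→* st ◅◅ (≡-lam p₁ →≡-refl ◅ ε) , fun-op d'
↝-→≡-commute hB [] (fun d) (≡-lam p₁ p₂) with ↝-→≡-commute (◂-→≡ p₁ hB) [] d p₂
... | b , st , d' = lam _ b , lam-→* st ◅◅ (≡-lam p₁ →≡-refl ◅ ε) , fun d'

↝-→*-commute : B ⨾ s ⊩ v ↝ v' → v →* w → ∃[ w' ] v' →* w' × B ⨾ s ⊩ w ↝ w'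
↝-→*-commute d ε = _ , ε , d
↝-→*-commute d (r ◅ rs) with ↝-→≡-commute (λ _ → →≡-refl) (Pointwise.refl →≡-refl) d r
... | _ , st₁ , d₁ with ↝-→*-commute d₁ rs
... | w' , st₂ , d₂ = w' , st₁ ◅◅ st₂ , d₂

top-↝ : B ⨾ s ⊩ top ↝ w → w ≡ top
top-↝ to-top        = refl
top-↝ (by-→≡ ≡-top) = refl

lam-↝ : B ⨾ s ⊩ lam a b ↝ w → w ≡ top ⊎ ∃[ a' ] ∃[ b' ] w ≡ lam a' b' × a →≡ a'
lam-↝ to-top              = inj₁ refl
lam-↝ (by-→≡ (≡-lam p _)) = inj₂ (_ , _ , refl , p)
lam-↝ (fun-op _)          = inj₂ (_ , _ , refl , →≡-refl)
lam-↝ (fun _)             = inj₂ (_ , _ , refl , →≡-refl)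

DomainReduct : Term → Term → Set
DomainReduct t y = y →* top ⊎ ∃[ a ] ∃[ b ] t →* a × y →* lam a b

↝-DomainReduct : B ⨾ s ⊩ v ↝ v' → DomainReduct t v → DomainReduct t v'
↝-DomainReduct d (inj₁ v↠⊤) with ↝-→*-commute d v↠⊤
... | _ , v'↠w , ⊤↝w = inj₁ (transport (_ →*_) (top-↝ ⊤↝w) v'↠w)
↝-DomainReduct d (inj₂ (a , b , t↠a , v↠lam)) with ↝-→*-commute d v↠lam
... | _ , v'↠w , lam↝w with lam-↝ lam↝w
... | inj₁ refl                     = inj₁ v'↠w
... | inj₂ (a' , b' , refl , a→a') = inj₂ (a' , b' , t↠a ◅◅ (a→a' ◅ ε) , v'↠w)

≤-DomainReduct : Γ ⨾ s ⊢ v ≤ w → DomainReduct t v → DomainReduct t w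
≤-DomainReduct (c-refl _)   p = p
≤-DomainReduct (c-step r c) p = ≤-DomainReduct c (↝-DomainReduct (↝-from-→≤ r) p)
≤-DomainReduct (c-back c e) p with ≤-DomainReduct c p
... | inj₁ w'↠⊤                    = inj₁ (e ◅ w'↠⊤)
... | inj₂ (a , b , t↠a , w'↠lam) = inj₂ (a , b , t↠a , e ◅ w'↠lam)

≤*-DomainReduct : Γ ⨾ s ⊢ v ≤* w → DomainReduct t v → DomainReduct t w
≤*-DomainReduct [ c ]    p = ≤-DomainReduct c p
≤*-DomainReduct (c ∷ cs) p = ≤*-DomainReduct cs (≤-DomainReduct c p)

Closure-prevalid : ∀ {R} → Closure R Γ s v w → Prevalid Γ s
Closure-prevalid (c-refl pv)  = pv
Closure-prevalid (c-step _ c) = Closure-prevalid c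
Closure-prevalid (c-back c _) = Closure-prevalid c

≤*-prevalid : Γ ⨾ s ⊢ v ≤* w → Prevalid Γ s
≤*-prevalid [ c ]   = Closure-prevalid c
≤*-prevalid (c ∷ _) = Closure-prevalid c

→*⇒≡ : Prevalid Γ s → v →* w → Γ ⨾ s ⊢ v ≡ w
→*⇒≡ pv ε        = c-refl pv
→*⇒≡ pv (r ◅ rs) = c-step r (→*⇒≡ pv rs)

≡-expand* : Γ ⨾ s ⊢ v ≡ w → u →* w → Γ ⨾ s ⊢ v ≡ u
≡-expand* c ε        = c
≡-expand* c (r ◅ rs) = c-back (≡-expand* c rs) r

lemma5p7 : (Γ : Ctx) (s : Stack) (t u t' u' : Term) →
           Γ ⨾ s ⊢ lam t u ≤* lam t' u' → Γ ⨾ s ⊢ t ≡ t'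
lemma5p7 Γ s t u t' u' lam≤*lam with ≤*-DomainReduct lam≤*lam (inj₂ (t , u , ε , ε))
... | inj₁ lam↠⊤ with lam-→*-inv lam↠⊤
...   | _ , _ , () , _
lemma5p7 Γ s t u t' u' lam≤*lam | inj₂ (a , _ , t↠a , lam↠lam) with lam-→*-inv lam↠lam
... | _ , _ , refl , t'↠a = ≡-expand* (→*⇒≡ (≤*-prevalid lam≤*lam) t↠a) t'↠a
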